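{- For every integer $n \geq 0$, \[ E_n^{*}(x) = \sum_{l=0}^n S_2(n,l)\, c_l(x). \]
   Context: All generating functions are formal power series in $t$. The type 2 Euler polynomials $E_n^{*}(x)$ are defined by $\frac{2}{e^t+e^{ -t}}e^{xt} = \sum_{n\ge 0} E_n^{*}(x)\frac{t^n}{n!}$. The type 2 Changhee polynomials $c_n(x)$ are defined by $\frac{2}{(1+t)+(1+t)^{ -1}}(1+t)^x = \sum_{n\ge0} c_n(x)\frac{t^n}{n!}$. The Stirling numbers of the second kind $S_2(n,l)$ are defined by $\frac{1}{l!}(e^t-1)^l = \sum_{n\ge l} S_2(n,l)\frac{t^n}{n!}$. -}

module Defs where

open import Data.Nat as ℕ using (ℕ; zero; suc; _∸_; _!)
open import Data.Nat.Properties using (_!≢0)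
open import Data.Integer using (+_)
open import Data.Rational using (ℚ; 0ℚ; 1ℚ; ½; _+_; _*_; -_; _-_; _/_)

ℕ→ℚ : ℕ → ℚ
ℕ→ℚ n = (+ n) / 1

invFact : ℕ → ℚ
invFact n = (+ 1) / (n !)
  where instance _ = n !≢0

_^ℚ_ : ℚ → ℕ → ℚ
q ^ℚ zero  = 1ℚ
q ^ℚ suc n = q * (q ^ℚ n)

falling : ℚ → ℕ → ℚ
falling x zero    = 1ℚ
falling x (suc n) = falling x n * (x - ℕ→ℚ n)

sumTo : ℕ → (ℕ → ℚ) → ℚ
sumTo zero    f = f 0
sumTo (suc n) f = sumTo n f + f (suc n)

-- Formal power series in t over ℚ, as coefficient sequences:
-- F n is the coefficient of t^n.

Series : Set
Series = ℕ → ℚ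

coeff : Series → ℕ → ℚ
coeff F n = F n

constS : ℚ → Series
constS c zero    = c
constS c (suc n) = 0ℚ

_⊕_ : Series → Series → Series
(F ⊕ G) n = F n + G n

_·_ : ℚ → Series → Series
(c · F) n = c * F n

_⊛_ : Series → Series → Series
(F ⊛ G) n = sumTo n (λ k → F k * G (n ∸ k))

powS : Series → ℕ → Series
powS F zero    = constS 1ℚ
powS F (suc l) = F ⊛ powS F l

-- Multiplicative inverse of a series F with constant term F 0 = 1:
-- B 0 = 1,  B (n+1) = - Σ_{k=1}^{n+1} F k * B (n+1-k).
-- invRev F n is the list [B n, B (n-1), ..., B 0] (as a function ℕ → ℚ,
-- index j ↦ B (n - j)).
private
  invRev : Series → ℕ → (ℕ → ℚ)
  invRev F zero    j = 1ℚ
  invRev F (suc n) zero    =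
    - sumTo n (λ j → F (suc j) * invRev F n j)
  invRev F (suc n) (suc j) = invRev F n j

inv₁ : Series → Series
inv₁ F n = invRev F n 0

expS : ℚ → Series
expS c n = (c ^ℚ n) * invFact n

-- (1+t)^x = Σ binom(x,n) t^n   (generalized binomial series)
binS : ℚ → Series
binS x n = falling x n * invFact n

onePlusT : Series
onePlusT zero          = 1ℚ
onePlusT (suc zero)    = 1ℚ
onePlusT (suc (suc n)) = 0ℚ

-- Type 2 Euler polynomials:  2/(e^t + e^{-t}) e^{xt} = Σ E*_n(x) t^n/n!
-- (2/(e^t+e^{-t}) is the inverse of ½(e^t+e^{-t}), which has constant term 1.)
Estar : ℕ → ℚ → ℚ
Estar n x = ℕ→ℚ (n !) *
  coeff (inv₁ (½ · (expS 1ℚ ⊕ expS (- 1ℚ))) ⊛ expS x) n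

-- Type 2 Changhee polynomials:
--  2/((1+t)+(1+t)^{-1}) (1+t)^x = Σ c_n(x) t^n/n!
changhee : ℕ → ℚ → ℚ
changhee n x = ℕ→ℚ (n !) *
  coeff (inv₁ (½ · (onePlusT ⊕ inv₁ onePlusT)) ⊛ binS x) n

-- Stirling numbers of the second kind: (1/l!)(e^t-1)^l = Σ S2(n,l) t^n/n!
S2 : ℕ → ℕ → ℚ
S2 n l = ℕ→ℚ (n !) *
  coeff (invFact l · powS (expS 1ℚ ⊕ constS (- 1ℚ)) l) n

-- Substituting Q = e^t − 1 for t is a ring homomorphism of formal power series (proved coefficientwise
-- by strong induction from the Horner form F(Q) = F(0) + Q · (shift F)(Q)); it fixes 1, hence commutes
-- with inverses. It sends (1+t)^x to e^{xt}, since both have constant term 1 and satisfy F′ = x F.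
-- So (1+t)^{±1} goes to e^{±t}, the generating function of the c_n(x) goes to that of the E*_n(x),
-- and comparing coefficients of t^n, where (e^t − 1)^l / l! contributes S₂(n,l) t^n / n!, gives the identity.
module Submission where

open import Defs
open import Data.Nat as ℕ using (ℕ; zero; suc; _∸_; _!; _≤_; _<_; z≤n; s≤s)
import Data.Nat.Properties as ℕₚ
open import Data.Nat.Induction using (<-rec)
import Data.Integer as ℤ
import Data.Integer.Tactic.RingSolver as ℤ-Solver
open import Data.Rational using (ℚ; toℚᵘ; 0ℚ; 1ℚ; ½; _+_; _*_; -_; _-_; _/_)
open import Data.Rational.Properties
import Data.Rational.Unnormalised as ℚᵘ
import Data.Rational.Unnormalised.Properties as ℚᵘₚ
open import Data.Sum using (inj₁; inj₂)
open import Level using (0ℓ)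
open import Relation.Nullary.Decidable using (dec⇒maybe)
open import Relation.Binary.PropositionalEquality
import Relation.Binary.Reasoning.Setoid
open import Algebra.Bundles using (CommutativeRing)
open import Algebra.Properties.CommutativeSemigroup
  (CommutativeRing.*-commutativeSemigroup +-*-commutativeRing) using (x∙yz≈y∙xz; xy∙z≈y∙xz)
import Algebra.Properties.CommutativeSemigroup
  (CommutativeRing.+-commutativeSemigroup +-*-commutativeRing) as +-Comm
open import Tactic.RingSolver using (solve-∀)
open import Tactic.RingSolver.Core.AlmostCommutativeRing
  using (AlmostCommutativeRing; fromCommutativeRing)

-- The zero test lets the solver discard monomials whose coefficients cancel.
ℚ-ring : AlmostCommutativeRing 0ℓ 0ℓ
ℚ-ring = fromCommutativeRing +-*-commutativeRing (λ q → dec⇒maybe (0ℚ ≟ q))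

ℕ→ℚ-suc : ∀ n → ℕ→ℚ (suc n) ≡ 1ℚ + ℕ→ℚ n
ℕ→ℚ-suc n = toℚᵘ-injective (begin
  toℚᵘ (ℕ→ℚ (suc n))                          ≈⟨ toℚᵘ-ℕ→ℚ (suc n) ⟩
  ℚᵘ.mkℚᵘ (ℤ.+ suc n) 0                       ≈⟨ ℚᵘ.*≡* (integer-identity (ℤ.+ n)) ⟩
  ℚᵘ.mkℚᵘ (ℤ.+ 1) 0 ℚᵘ.+ ℚᵘ.mkℚᵘ (ℤ.+ n) 0   ≈⟨ ℚᵘₚ.+-cong (toℚᵘ-ℕ→ℚ 1) (toℚᵘ-ℕ→ℚ n) ⟨
  toℚᵘ 1ℚ ℚᵘ.+ toℚᵘ (ℕ→ℚ n)                   ≈⟨ toℚᵘ-homo-+ 1ℚ (ℕ→ℚ n) ⟨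
  toℚᵘ (1ℚ + ℕ→ℚ n)                           ∎)
  where
  open ℚᵘₚ.≃-Reasoning
  toℚᵘ-ℕ→ℚ : ∀ m → toℚᵘ (ℕ→ℚ m) ℚᵘ.≃ ℚᵘ.mkℚᵘ (ℤ.+ m) 0
  toℚᵘ-ℕ→ℚ m = toℚᵘ-fromℚᵘ (ℚᵘ.mkℚᵘ (ℤ.+ m) 0)
  integer-identity : ∀ z → (ℤ.+ 1 ℤ.+ z) ℤ.* ℤ.+ 1 ≡ (ℤ.+ 1 ℤ.* ℤ.+ 1 ℤ.+ z ℤ.* ℤ.+ 1) ℤ.* ℤ.+ 1
  integer-identity = ℤ-Solver.solve-∀

ℕ→ℚ-+ : ∀ m n → ℕ→ℚ (m ℕ.+ n) ≡ ℕ→ℚ m + ℕ→ℚ n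
ℕ→ℚ-+ zero    n = sym (+-identityˡ (ℕ→ℚ n))
ℕ→ℚ-+ (suc m) n = begin
  ℕ→ℚ (suc (m ℕ.+ n))      ≡⟨ ℕ→ℚ-suc (m ℕ.+ n) ⟩
  1ℚ + ℕ→ℚ (m ℕ.+ n)       ≡⟨ cong (1ℚ +_) (ℕ→ℚ-+ m n) ⟩
  1ℚ + (ℕ→ℚ m + ℕ→ℚ n)     ≡⟨ +-assoc 1ℚ (ℕ→ℚ m) (ℕ→ℚ n) ⟨
  (1ℚ + ℕ→ℚ m) + ℕ→ℚ n     ≡⟨ cong (_+ ℕ→ℚ n) (ℕ→ℚ-suc m) ⟨
  ℕ→ℚ (suc m) + ℕ→ℚ n      ∎
  where open ≡-Reasoning

ℕ→ℚ-* : ∀ m n → ℕ→ℚ (m ℕ.* n) ≡ ℕ→ℚ m * ℕ→ℚ n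
ℕ→ℚ-* zero    n = sym (*-zeroˡ (ℕ→ℚ n))
ℕ→ℚ-* (suc m) n = begin
  ℕ→ℚ (n ℕ.+ m ℕ.* n)          ≡⟨ ℕ→ℚ-+ n (m ℕ.* n) ⟩
  ℕ→ℚ n + ℕ→ℚ (m ℕ.* n)        ≡⟨ cong (ℕ→ℚ n +_) (ℕ→ℚ-* m n) ⟩
  ℕ→ℚ n + ℕ→ℚ m * ℕ→ℚ n        ≡⟨ cong (_+ ℕ→ℚ m * ℕ→ℚ n) (*-identityˡ (ℕ→ℚ n)) ⟨
  1ℚ * ℕ→ℚ n + ℕ→ℚ m * ℕ→ℚ n   ≡⟨ *-distribʳ-+ (ℕ→ℚ n) 1ℚ (ℕ→ℚ m) ⟨
  (1ℚ + ℕ→ℚ m) * ℕ→ℚ n         ≡⟨ cong (_* ℕ→ℚ n) (ℕ→ℚ-suc m) ⟨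
  ℕ→ℚ (suc m) * ℕ→ℚ n          ∎
  where open ≡-Reasoning

1/n*n≡1 : ∀ n .{{_ : ℕ.NonZero n}} → ((ℤ.+ 1) / n) * ℕ→ℚ n ≡ 1ℚ
1/n*n≡1 (suc k) = toℚᵘ-injective (begin
  toℚᵘ (1/n * ℕ→ℚ (suc k))             ≈⟨ toℚᵘ-homo-* 1/n (ℕ→ℚ (suc k)) ⟩
  toℚᵘ 1/n ℚᵘ.* toℚᵘ (ℕ→ℚ (suc k))     ≈⟨ ℚᵘₚ.*-cong (toℚᵘ-fromℚᵘ (ℚᵘ.1/ n)) (toℚᵘ-fromℚᵘ n) ⟩
  ℚᵘ.1/ n ℚᵘ.* n                       ≈⟨ ℚᵘₚ.*-inverseˡ n ⟩
  ℚᵘ.1ℚᵘ                               ∎)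
  where
  open ℚᵘₚ.≃-Reasoning
  1/n : ℚ
  1/n = (ℤ.+ 1) / suc k
  n : ℚᵘ.ℚᵘ
  n = ℚᵘ.mkℚᵘ (ℤ.+ suc k) 0

*-cancelʳ-ℕ→ℚ : ∀ n .{{_ : ℕ.NonZero n}} {a b} → a * ℕ→ℚ n ≡ b * ℕ→ℚ n → a ≡ b
*-cancelʳ-ℕ→ℚ n {a} {b} eq = begin
  a                     ≡⟨ *-identityʳ a ⟨
  a * 1ℚ                ≡⟨ cong (a *_) n*1/n≡1 ⟨
  a * (ℕ→ℚ n * 1/n)     ≡⟨ *-assoc a (ℕ→ℚ n) 1/n ⟨
  a * ℕ→ℚ n * 1/n       ≡⟨ cong (_* 1/n) eq ⟩
  b * ℕ→ℚ n * 1/n       ≡⟨ *-assoc b (ℕ→ℚ n) 1/n ⟩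
  b * (ℕ→ℚ n * 1/n)     ≡⟨ cong (b *_) n*1/n≡1 ⟩
  b * 1ℚ                ≡⟨ *-identityʳ b ⟩
  b                     ∎
  where
  open ≡-Reasoning
  1/n = (ℤ.+ 1) / n
  n*1/n≡1 : ℕ→ℚ n * 1/n ≡ 1ℚ
  n*1/n≡1 = trans (*-comm (ℕ→ℚ n) 1/n) (1/n*n≡1 n)

invFact-*-! : ∀ n → invFact n * ℕ→ℚ (n !) ≡ 1ℚ
invFact-*-! n = 1/n*n≡1 (n !) {{n ℕₚ.!≢0}}

invFact-suc : ∀ n → ℕ→ℚ (suc n) * invFact (suc n) ≡ invFact n
invFact-suc n = *-cancelʳ-ℕ→ℚ (n !) {{n ℕₚ.!≢0}} (begin
  ℕ→ℚ (suc n) * invFact (suc n) * ℕ→ℚ (n !)   ≡⟨ xy∙z≈y∙xz (ℕ→ℚ (suc n)) (invFact (suc n)) (ℕ→ℚ (n !)) ⟩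
  invFact (suc n) * (ℕ→ℚ (suc n) * ℕ→ℚ (n !)) ≡⟨ cong (invFact (suc n) *_) (ℕ→ℚ-* (suc n) (n !)) ⟨
  invFact (suc n) * ℕ→ℚ (suc n !)             ≡⟨ invFact-*-! (suc n) ⟩
  1ℚ                                          ≡⟨ invFact-*-! n ⟨
  invFact n * ℕ→ℚ (n !)                       ∎)
  where open ≡-Reasoning

sumTo-cong-≤ : ∀ n {f g : ℕ → ℚ} → (∀ i → i ≤ n → f i ≡ g i) → sumTo n f ≡ sumTo n g
sumTo-cong-≤ zero    f≡g = f≡g 0 z≤n
sumTo-cong-≤ (suc n) f≡g =
  cong₂ _+_ (sumTo-cong-≤ n (λ i i≤n → f≡g i (ℕₚ.m≤n⇒m≤1+n i≤n))) (f≡g (suc n) ℕₚ.≤-refl)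

sumTo-cong : ∀ n {f g : ℕ → ℚ} → f ≗ g → sumTo n f ≡ sumTo n g
sumTo-cong n f≗g = sumTo-cong-≤ n (λ i _ → f≗g i)

sumTo-zero : ∀ n {f : ℕ → ℚ} → (∀ i → f i ≡ 0ℚ) → sumTo n f ≡ 0ℚ
sumTo-zero zero    f≡0 = f≡0 0
sumTo-zero (suc n) f≡0 = cong₂ _+_ (sumTo-zero n f≡0) (f≡0 (suc n))

sumTo-+ : ∀ n (f g : ℕ → ℚ) → sumTo n (λ i → f i + g i) ≡ sumTo n f + sumTo n g
sumTo-+ zero    f g = refl
sumTo-+ (suc n) f g = trans (cong (_+ (f (suc n) + g (suc n))) (sumTo-+ n f g))
                            (+-Comm.interchange (sumTo n f) (sumTo n g) (f (suc n)) (g (suc n)))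

*-distribˡ-sumTo : ∀ n c (f : ℕ → ℚ) → c * sumTo n f ≡ sumTo n (λ i → c * f i)
*-distribˡ-sumTo zero    c f = refl
*-distribˡ-sumTo (suc n) c f =
  trans (*-distribˡ-+ c (sumTo n f) (f (suc n))) (cong (_+ c * f (suc n)) (*-distribˡ-sumTo n c f))

*-distribʳ-sumTo : ∀ n c (f : ℕ → ℚ) → sumTo n f * c ≡ sumTo n (λ i → f i * c)
*-distribʳ-sumTo n c f = trans (*-comm (sumTo n f) c)
  (trans (*-distribˡ-sumTo n c f) (sumTo-cong n (λ i → *-comm c (f i))))

sumTo-uncons : ∀ n (f : ℕ → ℚ) → sumTo (suc n) f ≡ f 0 + sumTo n (λ i → f (suc i))
sumTo-uncons zero    f = refl
sumTo-uncons (suc n) f = trans (cong (_+ f (suc (suc n))) (sumTo-uncons n f))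
                               (+-assoc (f 0) (sumTo n (λ i → f (suc i))) (f (suc (suc n))))

sumTo-shift : ∀ n (f : ℕ → ℚ) → f 0 ≡ 0ℚ → f (suc n) ≡ 0ℚ → sumTo n (λ i → f (suc i)) ≡ sumTo n f
sumTo-shift n f f₀≡0 fₙ₊₁≡0 = begin
  sumTo n (λ i → f (suc i))        ≡⟨ +-identityˡ _ ⟨
  0ℚ + sumTo n (λ i → f (suc i))   ≡⟨ cong (_+ sumTo n (λ i → f (suc i))) f₀≡0 ⟨
  f 0 + sumTo n (λ i → f (suc i))  ≡⟨ sumTo-uncons n f ⟨
  sumTo n f + f (suc n)            ≡⟨ cong (sumTo n f +_) fₙ₊₁≡0 ⟩
  sumTo n f + 0ℚ                   ≡⟨ +-identityʳ (sumTo n f) ⟩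
  sumTo n f                        ∎
  where open ≡-Reasoning

sumTo-swap : ∀ n m (f : ℕ → ℕ → ℚ) →
  sumTo n (λ i → sumTo m (f i)) ≡ sumTo m (λ j → sumTo n (λ i → f i j))
sumTo-swap zero    m f = refl
sumTo-swap (suc n) m f = trans (cong (_+ sumTo m (f (suc n))) (sumTo-swap n m f))
                               (sym (sumTo-+ m (λ j → sumTo n (λ i → f i j)) (f (suc n))))

sumTo-reverse : ∀ n (f : ℕ → ℚ) → sumTo n f ≡ sumTo n (λ k → f (n ∸ k))
sumTo-reverse zero    f = refl
sumTo-reverse (suc n) f = begin
  sumTo n f + f (suc n)                  ≡⟨ cong (_+ f (suc n)) (sumTo-reverse n f) ⟩
  sumTo n (λ k → f (n ∸ k)) + f (suc n)  ≡⟨ +-comm (sumTo n (λ k → f (n ∸ k))) (f (suc n)) ⟩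
  f (suc n) + sumTo n (λ k → f (n ∸ k))  ≡⟨ sumTo-uncons n (λ k → f (suc n ∸ k)) ⟨
  sumTo (suc n) (λ k → f (suc n ∸ k))    ∎
  where open ≡-Reasoning

sumTo-trim : ∀ {m n} (f : ℕ → ℚ) → m ≤ n → (∀ i → m < i → i ≤ n → f i ≡ 0ℚ) →
  sumTo n f ≡ sumTo m f
sumTo-trim f m≤n tail≡0 with ℕₚ.m≤n⇒m<n∨m≡n m≤n
... | inj₂ refl = refl
sumTo-trim {m} {suc n} f _ tail≡0 | inj₁ m<1+n = begin
  sumTo n f + f (suc n) ≡⟨ cong₂ _+_ (sumTo-trim f (ℕₚ.≤-pred m<1+n) tail≡0′) (tail≡0 (suc n) m<1+n ℕₚ.≤-refl) ⟩
  sumTo m f + 0ℚ        ≡⟨ +-identityʳ (sumTo m f) ⟩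
  sumTo m f             ∎
  where
  open ≡-Reasoning
  tail≡0′ : ∀ i → m < i → i ≤ n → f i ≡ 0ℚ
  tail≡0′ i m<i i≤n = tail≡0 i m<i (ℕₚ.m≤n⇒m≤1+n i≤n)

sumTo-triangle : ∀ n (g : ℕ → ℕ → ℚ) →
  sumTo n (λ k → sumTo k (λ j → g j k)) ≡ sumTo n (λ j → sumTo (n ∸ j) (λ i → g j (j ℕ.+ i)))
sumTo-triangle zero    g = refl
sumTo-triangle (suc n) g = begin
  sumTo (suc n) (λ k → sumTo k (λ j → g j k))
    ≡⟨ sumTo-uncons n _ ⟩
  g 0 0 + sumTo n (λ k → sumTo (suc k) (λ j → g j (suc k)))
    ≡⟨ cong (g 0 0 +_) (sumTo-cong n (λ k → sumTo-uncons k (λ j → g j (suc k)))) ⟩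
  g 0 0 + sumTo n (λ k → g 0 (suc k) + inner k)
    ≡⟨ cong (g 0 0 +_) (sumTo-+ n (λ k → g 0 (suc k)) inner) ⟩
  g 0 0 + (sumTo n (λ k → g 0 (suc k)) + sumTo n inner)
    ≡⟨ +-assoc (g 0 0) _ _ ⟨
  (g 0 0 + sumTo n (λ k → g 0 (suc k))) + sumTo n inner
    ≡⟨ cong₂ _+_ (sym (sumTo-uncons n (g 0))) (sumTo-triangle n (λ j k → g (suc j) (suc k))) ⟩
  sumTo (suc n) (g 0) + sumTo n (λ j → sumTo (n ∸ j) (λ i → g (suc j) (suc (j ℕ.+ i))))
    ≡⟨ sumTo-uncons n _ ⟨
  sumTo (suc n) (λ j → sumTo (suc n ∸ j) (λ i → g j (j ℕ.+ i))) ∎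
  where
  open ≡-Reasoning
  inner : ℕ → ℚ
  inner k = sumTo k (λ j → g (suc j) (suc k))

module ≗-Reasoning = Relation.Binary.Reasoning.Setoid (ℕ →-setoid ℚ)

⊕-cong : ∀ {F F′ G G′} → F ≗ F′ → G ≗ G′ → (F ⊕ G) ≗ (F′ ⊕ G′)
⊕-cong F≗F′ G≗G′ n = cong₂ _+_ (F≗F′ n) (G≗G′ n)

·-congʳ : ∀ c {F F′} → F ≗ F′ → (c · F) ≗ (c · F′)
·-congʳ c F≗F′ n = cong (c *_) (F≗F′ n)

⊛-cong : ∀ {F F′ G G′} → F ≗ F′ → G ≗ G′ → (F ⊛ G) ≗ (F′ ⊛ G′)
⊛-cong F≗F′ G≗G′ n = sumTo-cong n (λ k → cong₂ _*_ (F≗F′ k) (G≗G′ (n ∸ k)))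

⊛-congˡ : ∀ G {F F′} → F ≗ F′ → (F ⊛ G) ≗ (F′ ⊛ G)
⊛-congˡ G {F} {F′} F≗F′ = ⊛-cong {F} {F′} {G} {G} F≗F′ (λ _ → refl)

⊛-congʳ : ∀ F {G G′} → G ≗ G′ → (F ⊛ G) ≗ (F ⊛ G′)
⊛-congʳ F {G} {G′} = ⊛-cong {F} {F} {G} {G′} (λ _ → refl)

⊛-comm : ∀ F G → (F ⊛ G) ≗ (G ⊛ F)
⊛-comm F G n = trans (sumTo-reverse n (λ k → F k * G (n ∸ k)))
  (sumTo-cong-≤ n (λ k k≤n → trans (cong (λ i → F (n ∸ k) * G i) (ℕₚ.m∸[m∸n]≡n k≤n))
                                   (*-comm (F (n ∸ k)) (G k))))

⊛-assoc : ∀ F G H → ((F ⊛ G) ⊛ H) ≗ (F ⊛ (G ⊛ H))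
⊛-assoc F G H n = begin
  sumTo n (λ k → sumTo k (λ j → F j * G (k ∸ j)) * H (n ∸ k))
    ≡⟨ sumTo-cong n (λ k → *-distribʳ-sumTo k (H (n ∸ k)) (λ j → F j * G (k ∸ j))) ⟩
  sumTo n (λ k → sumTo k (λ j → F j * G (k ∸ j) * H (n ∸ k)))
    ≡⟨ sumTo-triangle n (λ j k → F j * G (k ∸ j) * H (n ∸ k)) ⟩
  sumTo n (λ j → sumTo (n ∸ j) (λ i → F j * G (j ℕ.+ i ∸ j) * H (n ∸ (j ℕ.+ i))))
    ≡⟨ sumTo-cong n (λ j → trans (sumTo-cong (n ∸ j) (reindex j)) (sym (*-distribˡ-sumTo (n ∸ j) (F j) _))) ⟩
  sumTo n (λ j → F j * sumTo (n ∸ j) (λ i → G i * H (n ∸ j ∸ i))) ∎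
  where
  open ≡-Reasoning
  reindex : ∀ j i → F j * G (j ℕ.+ i ∸ j) * H (n ∸ (j ℕ.+ i)) ≡ F j * (G i * H (n ∸ j ∸ i))
  reindex j i = trans (cong₂ (λ a b → F j * G a * H b) (ℕₚ.m+n∸m≡n j i) (sym (ℕₚ.∸-+-assoc n j i)))
                      (*-assoc (F j) (G i) (H (n ∸ j ∸ i)))

⊛-distribˡ-⊕ : ∀ H F G → (H ⊛ (F ⊕ G)) ≗ ((H ⊛ F) ⊕ (H ⊛ G))
⊛-distribˡ-⊕ H F G n =
  trans (sumTo-cong n (λ k → *-distribˡ-+ (H k) (F (n ∸ k)) (G (n ∸ k)))) (sumTo-+ n _ _)

⊛-distribʳ-⊕ : ∀ H F G → ((F ⊕ G) ⊛ H) ≗ ((F ⊛ H) ⊕ (G ⊛ H))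
⊛-distribʳ-⊕ H F G n =
  trans (sumTo-cong n (λ k → *-distribʳ-+ (H (n ∸ k)) (F k) (G k))) (sumTo-+ n _ _)

⊛-·ʳ : ∀ F c G → (F ⊛ (c · G)) ≗ (c · (F ⊛ G))
⊛-·ʳ F c G n = trans (sumTo-cong n (λ k → x∙yz≈y∙xz (F k) c (G (n ∸ k))))
                     (sym (*-distribˡ-sumTo n c _))

constS-⊛ : ∀ c G → (constS c ⊛ G) ≗ (c · G)
constS-⊛ c G zero    = refl
constS-⊛ c G (suc n) = trans (sumTo-uncons n (λ k → constS c k * G (suc n ∸ k)))
  (trans (cong (c * G (suc n) +_) (sumTo-zero n (λ i → *-zeroˡ (G (n ∸ i)))))
         (+-identityʳ (c * G (suc n))))

constS-* : ∀ a b → constS (a * b) ≗ (a · constS b)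
constS-* a b zero    = refl
constS-* a b (suc n) = sym (*-zeroʳ a)

⊛-identityʳ : ∀ F → (F ⊛ constS 1ℚ) ≗ F
⊛-identityʳ F n = trans (⊛-comm F (constS 1ℚ) n) (trans (constS-⊛ 1ℚ F n) (*-identityˡ (F n)))

shift : Series → Series
shift F n = F (suc n)

shift-⊛ : ∀ F G → shift (F ⊛ G) ≗ ((shift F ⊛ G) ⊕ (F 0 · shift G))
shift-⊛ F G n = trans (sumTo-uncons n (λ k → F k * G (suc n ∸ k))) (+-comm (F 0 * G (suc n)) _)

⊛-cong-below : ∀ F {G H} n → F 0 ≡ 0ℚ → (∀ j → j < n → G j ≡ H j) → (F ⊛ G) n ≡ (F ⊛ H) n
⊛-cong-below F {G} {H} n F₀≡0 = go n
  where
  open ≡-Reasoning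
  F₀*x≡0 : ∀ x → F 0 * x ≡ 0ℚ
  F₀*x≡0 x = trans (cong (_* x) F₀≡0) (*-zeroˡ x)
  go : ∀ n → (∀ j → j < n → G j ≡ H j) → (F ⊛ G) n ≡ (F ⊛ H) n
  go zero    _   = trans (F₀*x≡0 (G 0)) (sym (F₀*x≡0 (H 0)))
  go (suc n) G≡H = begin
    sumTo (suc n) (λ k → F k * G (suc n ∸ k))                 ≡⟨ sumTo-uncons n _ ⟩
    F 0 * G (suc n) + sumTo n (λ i → F (suc i) * G (n ∸ i))  ≡⟨ cong₂ _+_ head tail ⟩
    F 0 * H (suc n) + sumTo n (λ i → F (suc i) * H (n ∸ i))  ≡⟨ sumTo-uncons n _ ⟨
    sumTo (suc n) (λ k → F k * H (suc n ∸ k))                 ∎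
    where
    head : F 0 * G (suc n) ≡ F 0 * H (suc n)
    head = trans (F₀*x≡0 (G (suc n))) (sym (F₀*x≡0 (H (suc n))))
    tail : sumTo n (λ i → F (suc i) * G (n ∸ i)) ≡ sumTo n (λ i → F (suc i) * H (n ∸ i))
    tail = sumTo-cong n (λ i → cong (F (suc i) *_) (G≡H (n ∸ i) (s≤s (ℕₚ.m∸n≤m n i))))

reversed-rows : ∀ (R : ℕ → ℕ → ℚ) {B : Series} →
  (∀ n → R n 0 ≡ B n) → (∀ n j → R (suc n) (suc j) ≡ R n j) → ∀ n j → j ≤ n → R n j ≡ B (n ∸ j)
reversed-rows R R₀ Rₛ n       zero    _         = R₀ n
reversed-rows R R₀ Rₛ (suc n) (suc j) (s≤s j≤n) = trans (Rₛ n j) (reversed-rows R R₀ Rₛ n j j≤n)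

-- inv₁ is computed through a private table of reversed rows that cannot be named here;
-- via-rows abstracts it as R, which unification solves from the first (definitional) equation.
inv₁-suc : ∀ F n → inv₁ F (suc n) ≡ - sumTo n (λ j → F (suc j) * inv₁ F (n ∸ j))
inv₁-suc F = via-rows _ (λ _ → refl) (λ _ → refl) (λ _ _ → refl)
  where
  via-rows : ∀ (R : ℕ → ℕ → ℚ) → (∀ n → inv₁ F (suc n) ≡ - sumTo n (λ j → F (suc j) * R n j)) →
    (∀ n → R n 0 ≡ inv₁ F n) → (∀ n j → R (suc n) (suc j) ≡ R n j) →
    ∀ n → inv₁ F (suc n) ≡ - sumTo n (λ j → F (suc j) * inv₁ F (n ∸ j))
  via-rows R unfold R₀ Rₛ n = trans (unfold n) (cong -_ (sumTo-cong-≤ n (λ j j≤n →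
    cong (F (suc j) *_) (reversed-rows R R₀ Rₛ n j j≤n))))

⊛-inverseʳ : ∀ F → F 0 ≡ 1ℚ → (F ⊛ inv₁ F) ≗ constS 1ℚ
⊛-inverseʳ F F₀≡1 zero    = trans (cong (_* 1ℚ) F₀≡1) (*-identityʳ 1ℚ)
⊛-inverseʳ F F₀≡1 (suc n) = begin
  sumTo (suc n) (λ k → F k * inv₁ F (suc n ∸ k)) ≡⟨ sumTo-uncons n _ ⟩
  F 0 * inv₁ F (suc n) + S                       ≡⟨ cong₂ (λ a b → a * b + S) F₀≡1 (inv₁-suc F n) ⟩
  1ℚ * (- S) + S                                 ≡⟨ cong (_+ S) (*-identityˡ (- S)) ⟩
  - S + S                                        ≡⟨ +-inverseˡ S ⟩
  0ℚ                                             ∎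
  where
  open ≡-Reasoning
  S = sumTo n (λ j → F (suc j) * inv₁ F (n ∸ j))

inv₁-unique : ∀ F G → F 0 ≡ 1ℚ → (G ⊛ F) ≗ constS 1ℚ → G ≗ inv₁ F
inv₁-unique F G F₀≡1 G⊛F≗1 = begin
  G                       ≈⟨ ⊛-identityʳ G ⟨
  G ⊛ constS 1ℚ           ≈⟨ ⊛-congʳ G (⊛-inverseʳ F F₀≡1) ⟨
  G ⊛ (F ⊛ inv₁ F)        ≈⟨ ⊛-assoc G F (inv₁ F) ⟨
  (G ⊛ F) ⊛ inv₁ F        ≈⟨ ⊛-congˡ (inv₁ F) G⊛F≗1 ⟩
  constS 1ℚ ⊛ inv₁ F      ≈⟨ constS-⊛ 1ℚ (inv₁ F) ⟩
  1ℚ · inv₁ F             ≈⟨ (λ n → *-identityˡ (inv₁ F n)) ⟩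
  inv₁ F                  ∎
  where open ≗-Reasoning

inv₁-cong : ∀ {F G} → F 0 ≡ 1ℚ → F ≗ G → inv₁ F ≗ inv₁ G
inv₁-cong {F} {G} F₀≡1 F≗G = inv₁-unique G (inv₁ F) (trans (sym (F≗G 0)) F₀≡1) (λ n → begin
  (inv₁ F ⊛ G) n    ≡⟨ ⊛-congʳ (inv₁ F) F≗G n ⟨
  (inv₁ F ⊛ F) n    ≡⟨ ⊛-comm (inv₁ F) F n ⟩
  (F ⊛ inv₁ F) n    ≡⟨ ⊛-inverseʳ F F₀≡1 n ⟩
  constS 1ℚ n       ∎)
  where open ≡-Reasoning

∂ : Series → Series
∂ F n = ℕ→ℚ (suc n) * F (suc n)

∂-constS : ∀ c n → ∂ (constS c) n ≡ 0ℚ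
∂-constS c n = *-zeroʳ (ℕ→ℚ (suc n))

∂-⊛ : ∀ F G → ∂ (F ⊛ G) ≗ ((∂ F ⊛ G) ⊕ (F ⊛ ∂ G))
∂-⊛ F G n = begin
  ℕ→ℚ (suc n) * sumTo (suc n) (λ k → F k * G (suc n ∸ k))
    ≡⟨ *-distribˡ-sumTo (suc n) (ℕ→ℚ (suc n)) _ ⟩
  sumTo (suc n) (λ k → ℕ→ℚ (suc n) * (F k * G (suc n ∸ k)))
    ≡⟨ sumTo-cong-≤ (suc n) split ⟩
  sumTo (suc n) (λ k → ℕ→ℚ k * F k * G (suc n ∸ k) + F k * (ℕ→ℚ (suc n ∸ k) * G (suc n ∸ k)))
    ≡⟨ sumTo-+ (suc n) _ _ ⟩
  sumTo (suc n) (λ k → ℕ→ℚ k * F k * G (suc n ∸ k)) + sumTo (suc n) (λ k → F k * (ℕ→ℚ (suc n ∸ k) * G (suc n ∸ k)))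
    ≡⟨ cong₂ _+_ left right ⟩
  (∂ F ⊛ G) n + (F ⊛ ∂ G) n ∎
  where
  open ≡-Reasoning
  split : ∀ k → k ≤ suc n →
    ℕ→ℚ (suc n) * (F k * G (suc n ∸ k)) ≡ ℕ→ℚ k * F k * G (suc n ∸ k) + F k * (ℕ→ℚ (suc n ∸ k) * G (suc n ∸ k))
  split k k≤1+n = begin
    ℕ→ℚ (suc n) * (F k * G (suc n ∸ k))
      ≡⟨ cong (λ m → ℕ→ℚ m * (F k * G (suc n ∸ k))) (ℕₚ.m+[n∸m]≡n k≤1+n) ⟨
    ℕ→ℚ (k ℕ.+ (suc n ∸ k)) * (F k * G (suc n ∸ k))
      ≡⟨ cong (_* (F k * G (suc n ∸ k))) (ℕ→ℚ-+ k (suc n ∸ k)) ⟩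
    (ℕ→ℚ k + ℕ→ℚ (suc n ∸ k)) * (F k * G (suc n ∸ k))
      ≡⟨ distribute (ℕ→ℚ k) (ℕ→ℚ (suc n ∸ k)) (F k) (G (suc n ∸ k)) ⟩
    ℕ→ℚ k * F k * G (suc n ∸ k) + F k * (ℕ→ℚ (suc n ∸ k) * G (suc n ∸ k)) ∎
    where
    distribute : ∀ a b f g → (a + b) * (f * g) ≡ a * f * g + f * (b * g)
    distribute = solve-∀ ℚ-ring
  left : sumTo (suc n) (λ k → ℕ→ℚ k * F k * G (suc n ∸ k)) ≡ (∂ F ⊛ G) n
  left = begin
    sumTo (suc n) (λ k → ℕ→ℚ k * F k * G (suc n ∸ k))    ≡⟨ sumTo-uncons n _ ⟩
    0ℚ * F 0 * G (suc n) + (∂ F ⊛ G) n                 ≡⟨ cong (λ z → z * G (suc n) + (∂ F ⊛ G) n) (*-zeroˡ (F 0)) ⟩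
    0ℚ * G (suc n) + (∂ F ⊛ G) n                       ≡⟨ cong (_+ (∂ F ⊛ G) n) (*-zeroˡ (G (suc n))) ⟩
    0ℚ + (∂ F ⊛ G) n                                   ≡⟨ +-identityˡ _ ⟩
    (∂ F ⊛ G) n                                        ∎
  right : sumTo (suc n) (λ k → F k * (ℕ→ℚ (suc n ∸ k) * G (suc n ∸ k))) ≡ (F ⊛ ∂ G) n
  right = begin
    sumTo n (λ k → F k * (ℕ→ℚ (suc n ∸ k) * G (suc n ∸ k))) + F (suc n) * (ℕ→ℚ (n ∸ n) * G (n ∸ n))
      ≡⟨ cong₂ _+_ (sumTo-cong-≤ n (λ k k≤n → cong (λ m → F k * (ℕ→ℚ m * G m)) (ℕₚ.+-∸-assoc 1 k≤n)))
                   (cong (λ m → F (suc n) * (ℕ→ℚ m * G m)) (ℕₚ.n∸n≡0 n)) ⟩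
    (F ⊛ ∂ G) n + F (suc n) * (0ℚ * G 0)
      ≡⟨ cong (λ z → (F ⊛ ∂ G) n + F (suc n) * z) (*-zeroˡ (G 0)) ⟩
    (F ⊛ ∂ G) n + F (suc n) * 0ℚ
      ≡⟨ cong ((F ⊛ ∂ G) n +_) (*-zeroʳ (F (suc n))) ⟩
    (F ⊛ ∂ G) n + 0ℚ
      ≡⟨ +-identityʳ _ ⟩
    (F ⊛ ∂ G) n ∎

∂-unique : ∀ x {F G} → ∂ F ≗ x · F → ∂ G ≗ x · G → F 0 ≡ G 0 → F ≗ G
∂-unique x         ∂F ∂G F₀≡G₀ zero    = F₀≡G₀
∂-unique x {F} {G} ∂F ∂G F₀≡G₀ (suc n) = *-cancelʳ-ℕ→ℚ (suc n) (begin
  F (suc n) * ℕ→ℚ (suc n)  ≡⟨ *-comm (F (suc n)) _ ⟩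
  ∂ F n                    ≡⟨ ∂F n ⟩
  x * F n                  ≡⟨ cong (x *_) (∂-unique x ∂F ∂G F₀≡G₀ n) ⟩
  x * G n                  ≡⟨ ∂G n ⟨
  ∂ G n                    ≡⟨ *-comm _ (G (suc n)) ⟩
  G (suc n) * ℕ→ℚ (suc n)  ∎)
  where open ≡-Reasoning

module Substitution (Q : Series) (Q₀≡0 : Q 0 ≡ 0ℚ) where

  powS-vanishes : ∀ {l n} → n < l → powS Q l n ≡ 0ℚ
  powS-vanishes {suc l} {n} (s≤s n≤l) =
    trans (⊛-cong-below Q {H = λ _ → 0ℚ} n Q₀≡0 (λ j j<n → powS-vanishes (ℕₚ.<-≤-trans j<n n≤l)))
          (sumTo-zero n (λ k → *-zeroʳ (Q k)))

  -- F (Q t): since Q 0 = 0, Q ^ l has no terms below t ^ l, so only l ≤ n contributes to t ^ n.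
  compose : Series → Series
  compose F n = sumTo n (λ l → F l * powS Q l n)

  compose-upTo : ∀ {N n} F → n ≤ N → sumTo N (λ l → F l * powS Q l n) ≡ compose F n
  compose-upTo F n≤N =
    sumTo-trim _ n≤N (λ l n<l _ → trans (cong (F l *_) (powS-vanishes n<l)) (*-zeroʳ (F l)))

  compose-cong : ∀ {F G} → F ≗ G → compose F ≗ compose G
  compose-cong F≗G n = sumTo-cong n (λ l → cong (_* powS Q l n) (F≗G l))

  compose-⊕ : ∀ F G → compose (F ⊕ G) ≗ (compose F ⊕ compose G)
  compose-⊕ F G n = trans (sumTo-cong n (λ l → *-distribʳ-+ (powS Q l n) (F l) (G l))) (sumTo-+ n _ _)

  compose-· : ∀ c F → compose (c · F) ≗ (c · compose F)
  compose-· c F n = trans (sumTo-cong n (λ l → *-assoc c (F l) (powS Q l n))) (sym (*-distribˡ-sumTo n c _))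

  compose-constS : ∀ c → compose (constS c) ≗ constS c
  compose-constS c n =
    trans (sumTo-trim {n = n} (λ l → constS c l * powS Q l n) z≤n
                      (λ { (suc l) _ _ → *-zeroˡ (powS Q (suc l) n) }))
          (c*δ n)
    where
    c*δ : ∀ n → c * constS 1ℚ n ≡ constS c n
    c*δ zero    = *-identityʳ c
    c*δ (suc n) = *-zeroʳ c

  compose-horner : ∀ F → compose F ≗ (constS (F 0) ⊕ (Q ⊛ compose (shift F)))
  compose-horner F zero = begin
    F 0 * 1ℚ                          ≡⟨ *-identityʳ (F 0) ⟩
    F 0                               ≡⟨ +-identityʳ (F 0) ⟨
    F 0 + 0ℚ                          ≡⟨ cong (F 0 +_) Q₀*c≡0 ⟨
    F 0 + Q 0 * compose (shift F) 0   ∎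
    where
    open ≡-Reasoning
    Q₀*c≡0 : Q 0 * compose (shift F) 0 ≡ 0ℚ
    Q₀*c≡0 = trans (cong (_* compose (shift F) 0) Q₀≡0) (*-zeroˡ (compose (shift F) 0))
  compose-horner F (suc m) = begin
    sumTo (suc m) (λ l → F l * powS Q l (suc m))
      ≡⟨ sumTo-uncons m _ ⟩
    F 0 * 0ℚ + sumTo m (λ i → F (suc i) * sumTo (suc m) (λ k → Q k * powS Q i (suc m ∸ k)))
      ≡⟨ cong₂ _+_ (*-zeroʳ (F 0)) (sumTo-cong m (λ i → *-distribˡ-sumTo (suc m) (F (suc i)) _)) ⟩
    0ℚ + sumTo m (λ i → sumTo (suc m) (λ k → F (suc i) * (Q k * powS Q i (suc m ∸ k))))
      ≡⟨ cong (0ℚ +_) (sumTo-swap m (suc m) _) ⟩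
    0ℚ + sumTo (suc m) (λ k → sumTo m (λ i → F (suc i) * (Q k * powS Q i (suc m ∸ k))))
      ≡⟨ cong (0ℚ +_) (sumTo-cong (suc m) (λ k → pull-Q k (suc m ∸ k))) ⟩
    0ℚ + (Q ⊛ (λ j → sumTo m (λ i → F (suc i) * powS Q i j))) (suc m)
      ≡⟨ cong (0ℚ +_) (⊛-cong-below Q (suc m) Q₀≡0 (λ j j<1+m → compose-upTo (shift F) (ℕₚ.≤-pred j<1+m))) ⟩
    0ℚ + (Q ⊛ compose (shift F)) (suc m) ∎
    where
    open ≡-Reasoning
    pull-Q : ∀ k j → sumTo m (λ i → F (suc i) * (Q k * powS Q i j)) ≡ Q k * sumTo m (λ i → F (suc i) * powS Q i j)
    pull-Q k j = trans (sumTo-cong m (λ i → x∙yz≈y∙xz (F (suc i)) (Q k) (powS Q i j)))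
                       (sym (*-distribˡ-sumTo m (Q k) _))

  compose-⊛ : ∀ F G → compose (F ⊛ G) ≗ (compose F ⊛ compose G)
  compose-⊛ F G n = <-rec Multiplicative step n F G
    where
    Multiplicative : ℕ → Set
    Multiplicative n = ∀ F G → compose (F ⊛ G) n ≡ (compose F ⊛ compose G) n

    step : ∀ n → (∀ {m} → m < n → Multiplicative m) → Multiplicative n
    step n IH F G = begin
      compose (F ⊛ G) n
        ≡⟨ compose-horner (F ⊛ G) n ⟩
      constS (F 0 * G 0) n + (Q ⊛ compose (shift (F ⊛ G))) n
        ≡⟨ cong₂ _+_ (constS-* (F 0) (G 0) n) (⊛-cong-below Q n Q₀≡0 lower) ⟩
      F 0 * constS (G 0) n + (Q ⊛ ((A ⊛ cG) ⊕ (F 0 · B))) n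
        ≡⟨ cong (F 0 * constS (G 0) n +_) (trans (⊛-distribˡ-⊕ Q (A ⊛ cG) (F 0 · B) n)
                                                 (cong ((Q ⊛ (A ⊛ cG)) n +_) (⊛-·ʳ Q (F 0) B n))) ⟩
      F 0 * constS (G 0) n + ((Q ⊛ (A ⊛ cG)) n + F 0 * (Q ⊛ B) n)
        ≡⟨ regroup (F 0) (constS (G 0) n) ((Q ⊛ (A ⊛ cG)) n) ((Q ⊛ B) n) ⟩
      F 0 * (constS (G 0) n + (Q ⊛ B) n) + (Q ⊛ (A ⊛ cG)) n
        ≡⟨ cong₂ _+_ (cong (F 0 *_) (compose-horner G n)) (⊛-assoc Q A cG n) ⟨
      F 0 * cG n + ((Q ⊛ A) ⊛ cG) n
        ≡⟨ cong (_+ ((Q ⊛ A) ⊛ cG) n) (constS-⊛ (F 0) cG n) ⟨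
      (constS (F 0) ⊛ cG) n + ((Q ⊛ A) ⊛ cG) n
        ≡⟨ ⊛-distribʳ-⊕ cG (constS (F 0)) (Q ⊛ A) n ⟨
      ((constS (F 0) ⊕ (Q ⊛ A)) ⊛ cG) n
        ≡⟨ ⊛-congˡ cG (compose-horner F) n ⟨
      (compose F ⊛ cG) n ∎
      where
      open ≡-Reasoning
      A = compose (shift F)
      B = compose (shift G)
      cG = compose G
      lower : ∀ j → j < n → compose (shift (F ⊛ G)) j ≡ ((A ⊛ cG) ⊕ (F 0 · B)) j
      lower j j<n = trans (compose-cong (shift-⊛ F G) j) (trans (compose-⊕ (shift F ⊛ G) (F 0 · shift G) j)
        (cong₂ _+_ (IH j<n (shift F) G) (compose-· (F 0) (shift G) j)))
      regroup : ∀ f c x y → f * c + (x + f * y) ≡ f * (c + y) + x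
      regroup = solve-∀ ℚ-ring

  compose-inv₁ : ∀ K → K 0 ≡ 1ℚ → compose (inv₁ K) ≗ inv₁ (compose K)
  compose-inv₁ K K₀≡1 = inv₁-unique (compose K) (compose (inv₁ K)) (trans (*-identityʳ (K 0)) K₀≡1) (begin
    compose (inv₁ K) ⊛ compose K  ≈⟨ compose-⊛ (inv₁ K) K ⟨
    compose (inv₁ K ⊛ K)          ≈⟨ compose-cong (λ n → trans (⊛-comm (inv₁ K) K n) (⊛-inverseʳ K K₀≡1 n)) ⟩
    compose (constS 1ℚ)           ≈⟨ compose-constS 1ℚ ⟩
    constS 1ℚ                     ∎)
    where open ≗-Reasoning

  ∂-compose : ∀ F n → ∂ (compose F) n ≡ sumTo (suc n) (λ l → F l * ∂ (powS Q l) n)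
  ∂-compose F n = trans (*-distribˡ-sumTo (suc n) (ℕ→ℚ (suc n)) _)
    (sumTo-cong (suc n) (λ l → x∙yz≈y∙xz (ℕ→ℚ (suc n)) (F l) (powS Q l (suc n))))

expm1 : Series
expm1 = expS 1ℚ ⊕ constS (- 1ℚ)

open Substitution expm1 refl

expS-1≗expm1+1 : expS 1ℚ ≗ (expm1 ⊕ constS 1ℚ)
expS-1≗expm1+1 zero    = refl
expS-1≗expm1+1 (suc n) = sym (trans (+-identityʳ _) (+-identityʳ _))

∂-expS : ∀ x → ∂ (expS x) ≗ (x · expS x)
∂-expS x n = begin
  ℕ→ℚ (suc n) * (x * (x ^ℚ n) * invFact (suc n))   ≡⟨ rearrange (ℕ→ℚ (suc n)) x (x ^ℚ n) (invFact (suc n)) ⟩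
  x * ((x ^ℚ n) * (ℕ→ℚ (suc n) * invFact (suc n)))  ≡⟨ cong (λ z → x * ((x ^ℚ n) * z)) (invFact-suc n) ⟩
  x * ((x ^ℚ n) * invFact n)                         ∎
  where
  open ≡-Reasoning
  rearrange : ∀ c x p i → c * (x * p * i) ≡ x * (p * (c * i))
  rearrange = solve-∀ ℚ-ring

∂-binS : ∀ x l → ∂ (binS x) l ≡ (x - ℕ→ℚ l) * binS x l
∂-binS x l = begin
  ℕ→ℚ (suc l) * (falling x l * (x - ℕ→ℚ l) * invFact (suc l))
    ≡⟨ rearrange (ℕ→ℚ (suc l)) (falling x l) (x - ℕ→ℚ l) (invFact (suc l)) ⟩
  (x - ℕ→ℚ l) * (falling x l * (ℕ→ℚ (suc l) * invFact (suc l)))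
    ≡⟨ cong (λ z → (x - ℕ→ℚ l) * (falling x l * z)) (invFact-suc l) ⟩
  (x - ℕ→ℚ l) * (falling x l * invFact l) ∎
  where
  open ≡-Reasoning
  rearrange : ∀ c f d i → c * (f * d * i) ≡ d * (f * (c * i))
  rearrange = solve-∀ ℚ-ring

∂-expm1 : ∂ expm1 ≗ expS 1ℚ
∂-expm1 n = begin
  ℕ→ℚ (suc n) * (expS 1ℚ (suc n) + 0ℚ)  ≡⟨ cong (ℕ→ℚ (suc n) *_) (+-identityʳ _) ⟩
  ∂ (expS 1ℚ) n                          ≡⟨ ∂-expS 1ℚ n ⟩
  1ℚ * expS 1ℚ n                         ≡⟨ *-identityˡ _ ⟩
  expS 1ℚ n                              ∎
  where open ≡-Reasoning

expS-1-⊛-powS : ∀ l → (expS 1ℚ ⊛ powS expm1 l) ≗ (powS expm1 (suc l) ⊕ powS expm1 l)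
expS-1-⊛-powS l n = begin
  (expS 1ℚ ⊛ powS expm1 l) n                              ≡⟨ ⊛-congˡ (powS expm1 l) expS-1≗expm1+1 n ⟩
  ((expm1 ⊕ constS 1ℚ) ⊛ powS expm1 l) n                  ≡⟨ ⊛-distribʳ-⊕ (powS expm1 l) expm1 (constS 1ℚ) n ⟩
  powS expm1 (suc l) n + (constS 1ℚ ⊛ powS expm1 l) n     ≡⟨ cong (powS expm1 (suc l) n +_) (constS-⊛ 1ℚ (powS expm1 l) n) ⟩
  powS expm1 (suc l) n + 1ℚ * powS expm1 l n              ≡⟨ cong (powS expm1 (suc l) n +_) (*-identityˡ _) ⟩
  powS expm1 (suc l) n + powS expm1 l n                   ∎
  where open ≡-Reasoning

∂-powS-suc : ∀ l → ∂ (powS expm1 (suc l)) ≗ (ℕ→ℚ (suc l) · (powS expm1 (suc l) ⊕ powS expm1 l))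
expm1-⊛-∂-powS : ∀ l → (expm1 ⊛ ∂ (powS expm1 l)) ≗ (ℕ→ℚ l · (powS expm1 (suc l) ⊕ powS expm1 l))

∂-powS-suc l n = begin
  ∂ (expm1 ⊛ powS expm1 l) n                                   ≡⟨ ∂-⊛ expm1 (powS expm1 l) n ⟩
  (∂ expm1 ⊛ powS expm1 l) n + (expm1 ⊛ ∂ (powS expm1 l)) n   ≡⟨ cong₂ _+_ (⊛-congˡ (powS expm1 l) ∂-expm1 n)
                                                                            (expm1-⊛-∂-powS l n) ⟩
  (expS 1ℚ ⊛ powS expm1 l) n + ℕ→ℚ l * X                       ≡⟨ cong (_+ ℕ→ℚ l * X) (expS-1-⊛-powS l n) ⟩
  X + ℕ→ℚ l * X                                                ≡⟨ cong (_+ ℕ→ℚ l * X) (*-identityˡ X) ⟨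
  1ℚ * X + ℕ→ℚ l * X                                           ≡⟨ *-distribʳ-+ X 1ℚ (ℕ→ℚ l) ⟨
  (1ℚ + ℕ→ℚ l) * X                                             ≡⟨ cong (_* X) (ℕ→ℚ-suc l) ⟨
  ℕ→ℚ (suc l) * X                                              ∎
  where
  open ≡-Reasoning
  X = powS expm1 (suc l) n + powS expm1 l n

expm1-⊛-∂-powS zero    n = begin
  sumTo n (λ k → expm1 k * ∂ (constS 1ℚ) (n ∸ k))  ≡⟨ sumTo-zero n expm1*0≡0 ⟩
  0ℚ                                              ≡⟨ *-zeroˡ (powS expm1 1 n + powS expm1 0 n) ⟨
  0ℚ * (powS expm1 1 n + powS expm1 0 n)          ∎
  where
  open ≡-Reasoning
  expm1*0≡0 : ∀ k → expm1 k * ∂ (constS 1ℚ) (n ∸ k) ≡ 0ℚ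
  expm1*0≡0 k = trans (cong (expm1 k *_) (∂-constS 1ℚ (n ∸ k))) (*-zeroʳ (expm1 k))
expm1-⊛-∂-powS (suc l) n = begin
  (expm1 ⊛ ∂ (powS expm1 (suc l))) n             ≡⟨ ⊛-congʳ expm1 (∂-powS-suc l) n ⟩
  (expm1 ⊛ (ℕ→ℚ (suc l) · X)) n                  ≡⟨ ⊛-·ʳ expm1 (ℕ→ℚ (suc l)) X n ⟩
  ℕ→ℚ (suc l) * (expm1 ⊛ X) n                    ≡⟨ cong (ℕ→ℚ (suc l) *_) (⊛-distribˡ-⊕ expm1 (powS expm1 (suc l)) (powS expm1 l) n) ⟩
  ℕ→ℚ (suc l) * (powS expm1 (suc (suc l)) n + powS expm1 (suc l) n) ∎
  where
  open ≡-Reasoning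
  X = powS expm1 (suc l) ⊕ powS expm1 l

∂-compose-binS : ∀ x → ∂ (compose (binS x)) ≗ (x · compose (binS x))
∂-compose-binS x n = begin
  ∂ (compose b) n
    ≡⟨ ∂-compose b n ⟩
  sumTo (suc n) (λ l → b l * ∂ (P l) n)
    ≡⟨ sumTo-uncons n _ ⟩
  b 0 * ∂ (P 0) n + sumTo n (λ i → b (suc i) * ∂ (P (suc i)) n)
    ≡⟨ cong₂ _+_ b₀*∂P₀≡0 (sumTo-cong n split) ⟩
  0ℚ + sumTo n (λ i → g (suc i) + h i)
    ≡⟨ +-identityˡ _ ⟩
  sumTo n (λ i → g (suc i) + h i)
    ≡⟨ sumTo-+ n (λ i → g (suc i)) h ⟩
  sumTo n (λ i → g (suc i)) + sumTo n h
    ≡⟨ cong (_+ sumTo n h) (sumTo-shift n g g₀≡0 gₙ₊₁≡0) ⟩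
  sumTo n g + sumTo n h
    ≡⟨ sumTo-+ n g h ⟨
  sumTo n (λ l → g l + h l)
    ≡⟨ sumTo-cong n (λ l → collect (ℕ→ℚ l) x (b l) (P l n)) ⟩
  sumTo n (λ l → x * (b l * P l n))
    ≡⟨ *-distribˡ-sumTo n x _ ⟨
  x * compose b n ∎
  where
  open ≡-Reasoning
  b : Series
  b = binS x
  P : ℕ → Series
  P = powS expm1
  g h : ℕ → ℚ
  g l = ℕ→ℚ l * b l * P l n
  h l = (x - ℕ→ℚ l) * b l * P l n
  spread : ∀ b c p q → b * (c * (p + q)) ≡ c * b * p + c * b * q
  spread = solve-∀ ℚ-ring
  collect : ∀ c x b p → c * b * p + (x - c) * b * p ≡ x * (b * p)
  collect = solve-∀ ℚ-ring
  split : ∀ i → b (suc i) * ∂ (P (suc i)) n ≡ g (suc i) + h i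
  split i = begin
    b (suc i) * ∂ (P (suc i)) n
      ≡⟨ cong (b (suc i) *_) (∂-powS-suc i n) ⟩
    b (suc i) * (ℕ→ℚ (suc i) * (P (suc i) n + P i n))
      ≡⟨ spread (b (suc i)) (ℕ→ℚ (suc i)) (P (suc i) n) (P i n) ⟩
    g (suc i) + ∂ b i * P i n
      ≡⟨ cong (λ z → g (suc i) + z * P i n) (∂-binS x i) ⟩
    g (suc i) + h i ∎
  b₀*∂P₀≡0 : b 0 * ∂ (P 0) n ≡ 0ℚ
  b₀*∂P₀≡0 = trans (cong (b 0 *_) (∂-constS 1ℚ n)) (*-zeroʳ (b 0))
  g₀≡0 : g 0 ≡ 0ℚ
  g₀≡0 = trans (cong (_* P 0 n) (*-zeroˡ (b 0))) (*-zeroˡ (P 0 n))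
  gₙ₊₁≡0 : g (suc n) ≡ 0ℚ
  gₙ₊₁≡0 = trans (cong (ℕ→ℚ (suc n) * b (suc n) *_) (powS-vanishes (ℕₚ.n<1+n n)))
                 (*-zeroʳ (ℕ→ℚ (suc n) * b (suc n)))

compose-binS : ∀ x → compose (binS x) ≗ expS x
compose-binS x = ∂-unique x (∂-compose-binS x) (∂-expS x) refl

compose-onePlusT : compose onePlusT ≗ expS 1ℚ
compose-onePlusT zero    = refl
compose-onePlusT (suc m) = begin
  compose onePlusT (suc m)               ≡⟨ sumTo-trim (λ l → onePlusT l * powS expm1 l (suc m)) (s≤s z≤n) beyond-t ⟩
  0ℚ + 1ℚ * (expm1 ⊛ constS 1ℚ) (suc m)  ≡⟨ trans (+-identityˡ _) (*-identityˡ _) ⟩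
  (expm1 ⊛ constS 1ℚ) (suc m)            ≡⟨ ⊛-identityʳ expm1 (suc m) ⟩
  expm1 (suc m)                          ≡⟨ +-identityʳ (expm1 (suc m)) ⟨
  expm1 (suc m) + 0ℚ                     ≡⟨ expS-1≗expm1+1 (suc m) ⟨
  expS 1ℚ (suc m)                        ∎
  where
  open ≡-Reasoning
  beyond-t : ∀ l → 1 < l → l ≤ suc m → onePlusT l * powS expm1 l (suc m) ≡ 0ℚ
  beyond-t (suc zero)    (s≤s ()) _
  beyond-t (suc (suc l)) _        _ = *-zeroˡ (powS expm1 (suc (suc l)) (suc m))

binS-neg1-suc : ∀ m → binS (- 1ℚ) (suc m) ≡ - binS (- 1ℚ) m
binS-neg1-suc m = *-cancelʳ-ℕ→ℚ (suc m) (begin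
  B (suc m) * ℕ→ℚ (suc m)       ≡⟨ *-comm (B (suc m)) (ℕ→ℚ (suc m)) ⟩
  ∂ B m                         ≡⟨ ∂-binS (- 1ℚ) m ⟩
  (- 1ℚ - ℕ→ℚ m) * B m          ≡⟨ negate (B m) (ℕ→ℚ m) ⟩
  - B m * (1ℚ + ℕ→ℚ m)          ≡⟨ cong (- B m *_) (ℕ→ℚ-suc m) ⟨
  - B m * ℕ→ℚ (suc m)           ∎)
  where
  open ≡-Reasoning
  B : Series
  B = binS (- 1ℚ)
  negate : ∀ b c → (- 1ℚ - c) * b ≡ - b * (1ℚ + c)
  negate = solve-∀ ℚ-ring

onePlusT-⊛-binS-neg1 : (onePlusT ⊛ binS (- 1ℚ)) ≗ constS 1ℚ
onePlusT-⊛-binS-neg1 zero    = refl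
onePlusT-⊛-binS-neg1 (suc m) = begin
  sumTo (suc m) (λ k → onePlusT k * B (suc m ∸ k))              ≡⟨ sumTo-uncons m _ ⟩
  1ℚ * B (suc m) + sumTo m (λ i → onePlusT (suc i) * B (m ∸ i)) ≡⟨ cong₂ _+_ (*-identityˡ (B (suc m))) only-t ⟩
  B (suc m) + B m                                                ≡⟨ cong (_+ B m) (binS-neg1-suc m) ⟩
  - B m + B m                                                    ≡⟨ +-inverseˡ (B m) ⟩
  0ℚ                                                             ∎
  where
  open ≡-Reasoning
  B : Series
  B = binS (- 1ℚ)
  only-t : sumTo m (λ i → onePlusT (suc i) * B (m ∸ i)) ≡ B m
  only-t = trans (sumTo-trim {n = m} _ z≤n (λ { (suc i) _ _ → *-zeroˡ (B (m ∸ suc i)) })) (*-identityˡ (B m))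

inv₁-onePlusT : inv₁ onePlusT ≗ binS (- 1ℚ)
inv₁-onePlusT n = sym (inv₁-unique onePlusT (binS (- 1ℚ)) refl
  (λ m → trans (⊛-comm (binS (- 1ℚ)) onePlusT m) (onePlusT-⊛-binS-neg1 m)) n)

coshS : Series
coshS = ½ · (expS 1ℚ ⊕ expS (- 1ℚ))

coshLog1pS : Series
coshLog1pS = ½ · (onePlusT ⊕ inv₁ onePlusT)

compose-coshLog1pS : compose coshLog1pS ≗ coshS
compose-coshLog1pS = begin
  compose (½ · (onePlusT ⊕ inv₁ onePlusT))            ≈⟨ compose-· ½ (onePlusT ⊕ inv₁ onePlusT) ⟩
  ½ · compose (onePlusT ⊕ inv₁ onePlusT)              ≈⟨ ·-congʳ ½ (compose-⊕ onePlusT (inv₁ onePlusT)) ⟩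
  ½ · (compose onePlusT ⊕ compose (inv₁ onePlusT))    ≈⟨ ·-congʳ ½ (⊕-cong compose-onePlusT compose-inv₁-onePlusT) ⟩
  ½ · (expS 1ℚ ⊕ expS (- 1ℚ))                         ∎
  where
  open ≗-Reasoning
  compose-inv₁-onePlusT : compose (inv₁ onePlusT) ≗ expS (- 1ℚ)
  compose-inv₁-onePlusT n = trans (compose-cong inv₁-onePlusT n) (compose-binS (- 1ℚ) n)

compose-changhee-gf : ∀ x → compose (inv₁ coshLog1pS ⊛ binS x) ≗ (inv₁ coshS ⊛ expS x)
compose-changhee-gf x = begin
  compose (inv₁ coshLog1pS ⊛ binS x)               ≈⟨ compose-⊛ (inv₁ coshLog1pS) (binS x) ⟩
  compose (inv₁ coshLog1pS) ⊛ compose (binS x)     ≈⟨ ⊛-cong (compose-inv₁ coshLog1pS refl) (compose-binS x) ⟩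
  inv₁ (compose coshLog1pS) ⊛ expS x               ≈⟨ ⊛-congˡ (expS x) (inv₁-cong refl compose-coshLog1pS) ⟩
  inv₁ coshS ⊛ expS x                              ∎
  where open ≗-Reasoning

S2-expansion : ∀ n (F : Series) → sumTo n (λ l → S2 n l * (ℕ→ℚ (l !) * F l)) ≡ ℕ→ℚ (n !) * compose F n
S2-expansion n F = trans (sumTo-cong n term) (sym (*-distribˡ-sumTo n N _))
  where
  open ≡-Reasoning
  N = ℕ→ℚ (n !)
  regroup : ∀ N i p f c → (N * (i * p)) * (f * c) ≡ N * (c * p) * (i * f)
  regroup = solve-∀ ℚ-ring
  term : ∀ l → S2 n l * (ℕ→ℚ (l !) * F l) ≡ N * (F l * powS expm1 l n)
  term l = begin
    N * (invFact l * powS expm1 l n) * (ℕ→ℚ (l !) * F l)  ≡⟨ regroup N (invFact l) (powS expm1 l n) (ℕ→ℚ (l !)) (F l) ⟩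
    N * (F l * powS expm1 l n) * (invFact l * ℕ→ℚ (l !))  ≡⟨ cong (N * (F l * powS expm1 l n) *_) (invFact-*-! l) ⟩
    N * (F l * powS expm1 l n) * 1ℚ                       ≡⟨ *-identityʳ _ ⟩
    N * (F l * powS expm1 l n)                            ∎

theorem2 : (n : ℕ) (x : ℚ) →
    Estar n x ≡ sumTo n (λ l → S2 n l * changhee l x)
theorem2 n x = begin
  ℕ→ℚ (n !) * (inv₁ coshS ⊛ expS x) n                          ≡⟨ cong (ℕ→ℚ (n !) *_) (compose-changhee-gf x n) ⟨
  ℕ→ℚ (n !) * compose (inv₁ coshLog1pS ⊛ binS x) n             ≡⟨ S2-expansion n (inv₁ coshLog1pS ⊛ binS x) ⟨
  sumTo n (λ l → S2 n l * changhee l x)                         ∎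
  where open ≡-Reasoning
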